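{- Let $G$ be a $(P_2+P_4,\,K_4-e)$-free graph. If $G$ contains an $F_3$, then either $\chi(G)\leq 6$ or $\chi(G)=\omega(G)$.
   Context: All graphs are finite, simple, undirected; $P_t$ is the chordless path on $t$ vertices, $K_4-e$ is $K_4$ minus one edge, $G_1+G_2$ is disjoint union, $\chi$ and $\omega$ are chromatic and clique number. "$G$ contains an $F_3$" means: $G$ has an induced chordless 5-cycle $v_1v_2v_3v_4v_5v_1$ together with two further vertices $b_1,b_4$ such that the neighbors of $b_1$ among $\{v_1,\dots,v_5\}$ are exactly $v_1,v_2$ and the neighbors of $b_4$ among $\{v_1,\dots,v_5\}$ are exactly $v_4,v_5$ ($b_1$ and $b_4$ may or may not be adjacent). -}

module Defs where

open import Data.Nat using (ℕ; _<_; _≡ᵇ_)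
open import Data.Fin using (Fin; toℕ)
open import Data.Bool using (Bool; true; false; _∧_; _∨_)
open import Data.List using (List; []; _∷_; any)
open import Data.Product using (Σ; _×_; _,_; ∃)
open import Relation.Binary.PropositionalEquality using (_≡_; _≢_)
open import Relation.Nullary using (¬_)
open import Function.Definitions using (Injective)
open import Data.Sum using (_⊎_)

record Graph (n : ℕ) : Set where
  field
    adj    : Fin n → Fin n → Bool
    sym    : ∀ u v → adj u v ≡ adj v u
    irrefl : ∀ v → adj v v ≡ false
open Graph public

Adj : ∀ {n} → Graph n → Fin n → Fin n → Set
Adj G u v = adj G u v ≡ true

edgeIn : ℕ → ℕ → List (ℕ × ℕ) → Bool
edgeIn i j [] = false
edgeIn i j ((a , b) ∷ es) =
  ((i ≡ᵇ a) ∧ (j ≡ᵇ b)) ∨ ((i ≡ᵇ b) ∧ (j ≡ᵇ a)) ∨ edgeIn i j es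

pattern' : (k : ℕ) → List (ℕ × ℕ) → Fin k → Fin k → Bool
pattern' k es i j = edgeIn (toℕ i) (toℕ j) es

InducedIn : ∀ {n} (G : Graph n) (k : ℕ) (H : Fin k → Fin k → Bool) → Set
InducedIn {n} G k H =
  Σ (Fin k → Fin n) λ f → Injective _≡_ _≡_ f ×
    (∀ i j → i ≢ j → adj G (f i) (f j) ≡ H i j)

P2+P4 : Fin 6 → Fin 6 → Bool
P2+P4 = pattern' 6 ((0 , 1) ∷ (2 , 3) ∷ (3 , 4) ∷ (4 , 5) ∷ [])

K4-e : Fin 4 → Fin 4 → Bool
K4-e = pattern' 4 ((0 , 2) ∷ (0 , 3) ∷ (1 , 2) ∷ (1 , 3) ∷ (2 , 3) ∷ [])

-- F3 with vertices v1..v5 = 0..4 (induced 5-cycle), b1 = 5 adjacent to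
-- exactly v1,v2, b4 = 6 adjacent to exactly v4,v5.
F3-edges : List (ℕ × ℕ)
F3-edges = (0 , 1) ∷ (1 , 2) ∷ (2 , 3) ∷ (3 , 4) ∷ (4 , 0)
         ∷ (5 , 0) ∷ (5 , 1) ∷ (6 , 3) ∷ (6 , 4) ∷ []

F3-nonadj : Fin 7 → Fin 7 → Bool
F3-nonadj = pattern' 7 F3-edges

F3-adj : Fin 7 → Fin 7 → Bool
F3-adj = pattern' 7 ((5 , 6) ∷ F3-edges)

ContainsF3 : ∀ {n} → Graph n → Set
ContainsF3 G = InducedIn G 7 F3-nonadj ⊎ InducedIn G 7 F3-adj

Colorable : ∀ {n} → Graph n → ℕ → Set
Colorable {n} G k =
  Σ (Fin n → Fin k) λ c → ∀ u v → Adj G u v → c u ≢ c v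

HasClique : ∀ {n} → Graph n → ℕ → Set
HasClique {n} G k =
  Σ (Fin k → Fin n) λ f → Injective _≡_ _≡_ f ×
    (∀ i j → i ≢ j → Adj G (f i) (f j))

IsChromaticNumber : ∀ {n} → Graph n → ℕ → Set
IsChromaticNumber G k = Colorable G k × (∀ m → m < k → ¬ Colorable G m)

IsCliqueNumber : ∀ {n} → Graph n → ℕ → Set
IsCliqueNumber G k = HasClique G k × (∀ m → k < m → ¬ HasClique G m)

-- Fix an induced F3 w = (v1, …, v5, b1, b4) and let X and Y be the sets of vertices adjacent
-- to every vertex of the triangle v1 v2 b1, respectively v4 v5 b4.  As G is K4−e-free, X and Y
-- are cliques together with their triangles, of sizes 3 + |X| and 3 + |Y|.  Call the adjacency
-- of a vertex to the seven vertices of w its trace.  A finite computation over traces, in which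
-- every excluded configuration is refuted by an explicit induced K4−e or P2+P4 on at most ten
-- vertices, shows:
--   only the traces of a fixed table occur, and the table gives each a base colour in 0…5;
--   adjacent vertices with equal base colours lie both in X or both in Y;
--   if |X| ≥ 2, vertices outside X adjacent to X have base colour 0, 1 or 2, and if |Y| ≥ 2,
--   vertices outside Y adjacent to Y have base colour 0, 1 or 3;
--   a vertex of Y has at most one neighbour in X, and a vertex of X at most one in Y.
-- So recolouring X (when |X| ≥ 2) with 3, 4, … and Y (when |Y| ≥ 2) with 2, 4, 5, …, every
-- vertex of Y avoiding the colour of its neighbour in X, is a proper colouring with
-- 3 + max(3, |X|, |Y|) colours: either 6 colours, or as many as one of the two cliques has.

module Submission where

open import Defs hiding (sym)
open import Agda.Builtin.FromNat using (Number; fromNat)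
open import Data.Bool using (Bool; true; false)
import Data.Bool.Properties as Bool
open import Data.Empty using (⊥; ⊥-elim)
open import Data.Fin using (Fin; zero; suc; _≟_; _↑ʳ_; inject≤)
import Data.Fin.Literals as Fin
open import Data.Fin.Properties
  using (any?; all?; ¬∀⟶∃¬; injective⇒≤; suc-injective; 0≢1+n; ↑ʳ-injective; inject≤-injective)
open import Data.List using (List; []; _∷_; length; lookup; filter; allFin; map)
open import Data.List.Membership.Propositional using (_∈_; _∉_)
open import Data.List.Membership.Propositional.Properties using (∈-lookup; ∈-filter⁺; ∈-filter⁻; ∈-allFin)
open import Data.List.Relation.Unary.All as All using (All; []; _∷_)
import Data.List.Relation.Unary.All.Properties as Allₚ
open import Data.List.Relation.Unary.AllPairs as AllPairs using (AllPairs; []; _∷_)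
import Data.List.Relation.Unary.AllPairs.Properties as AllPairsₚ
open import Data.List.Relation.Unary.Any as Any using (Any; here; there)
open import Data.List.Relation.Unary.Any.Properties using (lookup-index)
open import Data.List.Relation.Unary.Unique.Propositional using (Unique)
import Data.List.Relation.Unary.Unique.Propositional.Properties as Unique
open import Data.Nat using (ℕ; zero; suc; _+_; _≤_; _<_; _⊔_; s≤s; z≤n)
import Data.Nat.Literals as ℕ
open import Data.Nat.Properties using (<⇒≱; <⇒≤; ⊔-sel; ≤-trans; m≤m⊔n; m≤n⊔m)
open import Data.Product using (_×_; _,_; ∃; proj₁; proj₂)
import Data.Product as Product
open import Data.Product.Properties using (≡-dec)
open import Data.Sum using (_⊎_; inj₁; inj₂; [_,_]′)
open import Data.Unit using (tt)
open import Data.Vec using (Vec; []; _∷_)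
import Data.Vec as Vec
import Data.Vec.Properties as Vec
open import Data.Vec.Functional using () renaming (_∷_ to _◃_; [] to ◃[])
open import Function using (_∘_; flip; id)
open import Function.Definitions using (Injective)
open import Relation.Binary.Definitions using (Symmetric)
open import Relation.Binary.PropositionalEquality
  using (_≡_; _≢_; refl; sym; trans; cong; subst; subst₂; ≢-sym)
open import Relation.Nullary using (Dec; yes; no; ¬_; ¬?; contradiction)
open import Relation.Nullary.Decidable using (decidable-stable; map′; _×-dec_; _⊎-dec_; _→-dec_; from-yes)
open import Relation.Unary using (Pred; Decidable)

instance
  ℕ-number : Number ℕ
  ℕ-number = ℕ.number

  Fin-number : ∀ {n} → Number (Fin n)
  Fin-number = Fin.number _

allPairs-lookup : ∀ {a r} {A : Set a} {R : A → A → Set r} → Symmetric R →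
                  ∀ {xs} → AllPairs R xs → ∀ {i j} → i ≢ j → R (lookup xs i) (lookup xs j)
allPairs-lookup R-sym (_  ∷ _)   {zero}  {zero}  0≢0 = contradiction refl 0≢0
allPairs-lookup R-sym (Rx ∷ _)   {zero}  {suc j} _   = All.lookup Rx (∈-lookup j)
allPairs-lookup R-sym (Rx ∷ _)   {suc i} {zero}  _   = R-sym (All.lookup Rx (∈-lookup i))
allPairs-lookup R-sym (_  ∷ Rxs) {suc i} {suc j} i≢j = allPairs-lookup R-sym Rxs (i≢j ∘ cong suc)

lookup-injective : ∀ {a} {A : Set a} {xs : List A} → Unique xs →
                   ∀ {i j} → lookup xs i ≡ lookup xs j → i ≡ j
lookup-injective xs! {i} {j} eq = decidable-stable (i ≟ j) λ i≢j → allPairs-lookup ≢-sym xs! i≢j eq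

all-bools? : ∀ {p} {P : Pred Bool p} → Decidable P → Dec (∀ b → P b)
all-bools? P? = map′ (λ { (Pt , _) true → Pt ; (_ , Pf) false → Pf }) (λ ∀P → ∀P true , ∀P false)
                     (P? true ×-dec P? false)

all-vectors? : ∀ {k p} {P : Pred (Vec Bool k) p} → Decidable P → Dec (∀ s → P s)
all-vectors? {zero}  P? = map′ (λ { P[] [] → P[] }) (λ ∀P → ∀P []) (P? [])
all-vectors? {suc k} P? = map′ (λ { ∀P (b ∷ s) → ∀P b s }) (λ ∀P b s → ∀P (b ∷ s))
                               (all-bools? λ b → all-vectors? (P? ∘ (b ∷_)))

missed-value : ∀ {q f} → q < f → (h : Fin q → Fin f) → ∃ λ u → ∀ j → h j ≢ u
missed-value {q} q<f h = decidable-stable (any? λ u → all? λ j → ¬? (h j ≟ u)) λ nothing-missed →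
  let preimage : ∀ u → ∃ λ j → h j ≡ u
      preimage u = Product.map₂ (decidable-stable (h _ ≟ u))
                     (¬∀⟶∃¬ q _ (λ j → ¬? (h j ≟ u)) (nothing-missed ∘ (u ,_)))
  in <⇒≱ q<f (injective⇒≤ {f = proj₁ ∘ preimage} λ {a} {b} eq →
       trans (sym (proj₂ (preimage a))) (trans (cong h eq) (proj₂ (preimage b))))

◃-injective : ∀ {m f} {c : Fin f} {h : Fin m → Fin f} →
              (∀ j → h j ≢ c) → Injective _≡_ _≡_ h → Injective _≡_ _≡_ (c ◃ h)
◃-injective c-new h-inj {zero}  {zero}  _  = refl
◃-injective c-new h-inj {zero}  {suc j} eq = contradiction (sym eq) (c-new j)
◃-injective c-new h-inj {suc i} {zero}  eq = contradiction eq (c-new i)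
◃-injective c-new h-inj {suc i} {suc j} eq = cong suc (h-inj eq)

other-than : ∀ {f} → 2 ≤ f → (u : Fin f) → ∃ λ v → v ≢ u
other-than (s≤s (s≤s _)) zero    = suc zero , ≢-sym 0≢1+n
other-than (s≤s (s≤s _)) (suc _) = zero , 0≢1+n

record AvoidingInjection {q f} (R : Fin q → Fin f → Set) : Set where
  constructor avoiding
  field
    choice    : Fin q → Fin f
    injective : Injective _≡_ _≡_ choice
    avoids    : ∀ j → ¬ R j (choice j)

private
  avoiding-when-fresh-forbidden :
    ∀ {q f} {R : Fin (suc q) → Fin f → Set} → 2 ≤ f →
    (∀ {j c c′} → R j c → R j c′ → c ≡ c′) → (∀ {i j c} → R i c → R j c → i ≡ j) →
    (h : Fin q → Fin f) → Injective _≡_ _≡_ h → (∀ j → ¬ R (suc j) (h j)) →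
    (u : Fin f) → (∀ j → h j ≢ u) → R zero u → AvoidingInjection R
  avoiding-when-fresh-forbidden {zero} 2≤f functional _ _ _ _ u _ R₀u =
    let v , v≢u = other-than 2≤f u
    in avoiding (λ _ → v) (λ { {zero} {zero} _ → refl }) λ { zero R₀v → v≢u (functional R₀v R₀u) }
  -- u is forbidden only at 0, so 1 takes u and 0 takes over the old value of 1.
  avoiding-when-fresh-forbidden {suc q} {R = R} _ functional injective h h-inj h-avoids u u-new R₀u =
    avoiding (h zero ◃ u ◃ h ∘ suc)
             (◃-injective h₀-new (◃-injective (u-new ∘ suc) (suc-injective ∘ h-inj)))
             avoids
    where
    h₀-new : ∀ j → (u ◃ h ∘ suc) j ≢ h zero
    h₀-new zero    = ≢-sym (u-new zero)
    h₀-new (suc j) = ≢-sym 0≢1+n ∘ h-inj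
    avoids : ∀ j → ¬ R j ((h zero ◃ u ◃ h ∘ suc) j)
    avoids zero          R₀h₀ = u-new zero (functional R₀h₀ R₀u)
    avoids (suc zero)    R₁u  = ≢-sym 0≢1+n (injective R₁u R₀u)
    avoids (suc (suc j))      = h-avoids (suc j)

avoiding-injection :
  ∀ {q f} {R : Fin q → Fin f → Set} → q ≤ f → 2 ≤ f → (∀ j c → Dec (R j c)) →
  (∀ {j c c′} → R j c → R j c′ → c ≡ c′) → (∀ {i j c} → R i c → R j c → i ≡ j) →
  AvoidingInjection R
avoiding-injection {zero} _ _ _ _ _ = avoiding (λ ()) (λ { {()} }) λ ()
avoiding-injection {suc q} q<f 2≤f R? functional injective
  with avoiding-injection (<⇒≤ q<f) 2≤f (R? ∘ suc) functional
         (λ Ric Rjc → suc-injective (injective Ric Rjc))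
... | avoiding h h-inj h-avoids with missed-value q<f h
... | u , u-new with R? zero u
... | no ¬R₀u = avoiding (u ◃ h) (◃-injective u-new h-inj) λ { zero → ¬R₀u ; (suc j) → h-avoids j }
... | yes R₀u = avoiding-when-fresh-forbidden 2≤f functional injective h h-inj h-avoids u u-new R₀u

module Enumeration {n p} {P : Pred (Fin n) p} (P? : Decidable P) where

  members : List (Fin n)
  members = filter P? (allFin n)

  size : ℕ
  size = length members

  member : Fin size → Fin n
  member = lookup members

  ∈members⇒P : ∀ {u} → u ∈ members → P u
  ∈members⇒P = proj₂ ∘ ∈-filter⁻ P? {xs = allFin n}

  member-satisfies : ∀ i → P (member i)
  member-satisfies = ∈members⇒P ∘ ∈-lookup

  member-injective : Injective _≡_ _≡_ member
  member-injective = lookup-injective (Unique.filter⁺ P? (Unique.allFin⁺ n))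

  position : ∀ {u} → P u → Fin size
  position Pu = Any.index (∈-filter⁺ P? (∈-allFin _) Pu)

  member-position : ∀ {u} (Pu : P u) → member (position Pu) ≡ u
  member-position Pu = sym (lookup-index (∈-filter⁺ P? (∈-allFin _) Pu))

  position-injective : ∀ {u v} (Pu : P u) (Pv : P v) → position Pu ≡ position Pv → u ≡ v
  position-injective Pu Pv eq =
    trans (sym (member-position Pu)) (trans (cong member eq) (member-position Pv))

  members-pairwise : ∀ {r} {R : Fin n → Fin n → Set r} →
                     (∀ {u v} → P u → P v → u ≢ v → R u v) → AllPairs R members
  members-pairwise {R = R} R-from =
    discharge (Allₚ.all-filter P? (allFin n))
              (AllPairsₚ.filter⁺ P? (AllPairs.map (λ u≢v Pu Pv → R-from Pu Pv u≢v) (Unique.allFin⁺ n)))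
    where
    discharge : ∀ {xs} → All P xs → AllPairs (λ u v → P u → P v → R u v) xs → AllPairs R xs
    discharge []         []         = []
    discharge (Pu ∷ Pus) (Rs ∷ Rss) = All.zipWith (λ (Pv , Ruv) → Ruv Pu Pv) (Pus , Rs) ∷ discharge Pus Rss

module _ {n} (G : Graph n) where

  Adj⇒≢ : ∀ {u v} → Adj G u v → u ≢ v
  Adj⇒≢ {u} uv refl = contradiction (trans (sym uv) (irrefl G u)) λ ()

  Adj-sym : ∀ {u v} → Adj G u v → Adj G v u
  Adj-sym {u} {v} uv = trans (Graph.sym G v u) uv

  clique≤colours : ∀ {k m} → HasClique G k → Colorable G m → k ≤ m
  clique≤colours (f , _ , f-adj) (c , c-proper) = injective⇒≤ c∘f-injective
    where
    c∘f-injective : Injective _≡_ _≡_ (c ∘ f)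
    c∘f-injective {i} {j} eq = decidable-stable (i ≟ j) λ i≢j → c-proper _ _ (f-adj i j i≢j) eq

  χ≡ω : ∀ {k} → Colorable G k → HasClique G k → IsChromaticNumber G k × IsCliqueNumber G k
  χ≡ω col cl = (col , λ _ m<k → <⇒≱ m<k ∘ clique≤colours cl)
             , (cl  , λ _ k<m → <⇒≱ k<m ∘ flip clique≤colours col)

  colouring+cliques⇒χ≤6⊎χ≡ω :
    ∀ {p q} → Colorable G (3 + (3 ⊔ p ⊔ q)) → HasClique G (3 + p) → HasClique G (3 + q) →
    Colorable G 6 ⊎ ∃ λ k → IsChromaticNumber G k × IsCliqueNumber G k
  colouring+cliques⇒χ≤6⊎χ≡ω {p} {q} col cl-p cl-q with ⊔-sel (3 ⊔ p) q | ⊔-sel 3 p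
  ... | inj₂ M≡q   | _        = inj₂ (_ , χ≡ω (subst (Colorable G ∘ (3 +_)) M≡q col) cl-q)
  ... | inj₁ M≡3⊔p | inj₁ ⊔≡3 = inj₁ (subst (Colorable G ∘ (3 +_)) (trans M≡3⊔p ⊔≡3) col)
  ... | inj₁ M≡3⊔p | inj₂ ⊔≡p =
    inj₂ (_ , χ≡ω (subst (Colorable G ∘ (3 +_)) (trans M≡3⊔p ⊔≡p) col) cl-p)

  allPairs⇒clique : ∀ {xs} → AllPairs (Adj G) xs → HasClique G (length xs)
  allPairs⇒clique {xs} adjacent =
    lookup xs , lookup-injective (AllPairs.map Adj⇒≢ adjacent) , λ _ _ → allPairs-lookup Adj-sym adjacent

-- Patterns and their realisations

Pattern : ℕ → Set
Pattern m = Fin m → Fin m → Bool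

extend : ∀ {m} → Pattern m → (Fin m → Bool) → Pattern (suc m)
extend P r zero    zero    = false
extend P r zero    (suc j) = r j
extend P r (suc i) zero    = r i
extend P r (suc i) (suc j) = P i j

-- K4−e on vertices (x, y, a, b), given by extensions so that realises-◃ checks it row by row.
K4-e-by-extension : Pattern 4
K4-e-by-extension =
  extend (extend (extend (extend (λ ()) (λ ())) (λ _ → true)) (λ _ → true)) (false ◃ λ _ → true)

K4-e-by-extension≗K4-e : ∀ i j → K4-e-by-extension i j ≡ K4-e i j
K4-e-by-extension≗K4-e = from-yes (all? λ i → all? λ j → K4-e-by-extension i j Bool.≟ K4-e i j)

module _ {n} (G : Graph n) where

  Realises : ∀ {m} → (Fin m → Fin n) → Pattern m → Set
  Realises pt P = ∀ i j → i ≢ j → adj G (pt i) (pt j) ≡ P i j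

  realises-◃ : ∀ {m} {pt : Fin m → Fin n} {P r u} → Realises pt P →
               (∀ j → adj G u (pt j) ≡ r j) → Realises (u ◃ pt) (extend P r)
  realises-◃ _ _ zero zero 0≢0 = contradiction refl 0≢0
  realises-◃ _ row zero (suc j) _ = row j
  realises-◃ {pt = pt} {u = u} _ row (suc i) zero _ = trans (Graph.sym G (pt i) u) (row i)
  realises-◃ R _ (suc i) (suc j) i≢j = R i j (i≢j ∘ cong suc)

  common-neighbours-adjacent : ¬ InducedIn G 4 K4-e → ∀ {a b x y} →
    Adj G a b → Adj G x a → Adj G x b → Adj G y a → Adj G y b → x ≢ y → Adj G x y
  common-neighbours-adjacent K4-e-free {a} {b} {x} {y} ab xa xb ya yb x≢y with adj G x y in xy
  ... | true  = refl
  ... | false = ⊥-elim (K4-e-free (f , f-injective , λ i j i≢j →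
                  trans (f-realises i j i≢j) (K4-e-by-extension≗K4-e i j)))
    where
    f : Fin 4 → Fin n
    f = x ◃ y ◃ a ◃ b ◃ ◃[]
    f-injective : Injective _≡_ _≡_ f
    f-injective =
      ◃-injective (λ { zero → ≢-sym x≢y ; (suc zero) → ≢-sym (Adj⇒≢ G xa)
                     ; (suc (suc zero)) → ≢-sym (Adj⇒≢ G xb) })
      (◃-injective (λ { zero → ≢-sym (Adj⇒≢ G ya) ; (suc zero) → ≢-sym (Adj⇒≢ G yb) })
      (◃-injective (λ { zero → ≢-sym (Adj⇒≢ G ab) })
      λ { {zero} {zero} _ → refl }))
    f-realises : Realises f K4-e-by-extension
    f-realises =
      realises-◃ (realises-◃ (realises-◃ (realises-◃ (λ ()) λ ())
        λ { zero → ab ; (suc ()) })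
        λ { zero → ya ; (suc zero) → yb ; (suc (suc ())) })
        λ { zero → xy ; (suc zero) → xa ; (suc (suc zero)) → xb ; (suc (suc (suc ()))) }

-- Witnesses of forbidden induced subgraphs

-- Realisations need not be injective, but distinguishable vertices have distinct images.
Distinguishable : ∀ {m} → Pattern m → Fin m → Fin m → Set
Distinguishable P a b = (a ≢ b × P a b ≡ true) ⊎ ∃ λ r → a ≢ r × b ≢ r × P a r ≢ P b r

distinguishable? : ∀ {m} (P : Pattern m) a b → Dec (Distinguishable P a b)
distinguishable? P a b =
  (¬? (a ≟ b) ×-dec P a b Bool.≟ true) ⊎-dec
  any? λ r → ¬? (a ≟ r) ×-dec ¬? (b ≟ r) ×-dec ¬? (P a r Bool.≟ P b r)

distinguishable⇒≢ : ∀ {m} {P : Pattern m} {a b} → Distinguishable P a b → a ≢ b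
distinguishable⇒≢ (inj₁ (a≢b , _))               = a≢b
distinguishable⇒≢ (inj₂ (_ , _ , _ , differ)) refl = differ refl

InducedCopy : ∀ {k m} → Pattern k → (Fin k → Fin m) → Pattern m → Set
InducedCopy H c P = ∀ i j → i ≢ j → H i j ≡ P (c i) (c j) × Distinguishable P (c i) (c j)

inducedCopy? : ∀ {k m} (H : Pattern k) c (P : Pattern m) → Dec (InducedCopy H c P)
inducedCopy? H c P = all? λ i → all? λ j →
  ¬? (i ≟ j) →-dec (H i j Bool.≟ P (c i) (c j) ×-dec distinguishable? P (c i) (c j))

data Witness (m : ℕ) : Set where
  k4-e  : (a b c d : Fin m) → Witness m
  p2+p4 : (a b c d e f : Fin m) → Witness m

Witnesses : ∀ {m} → Witness m → Pattern m → Set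
Witnesses (k4-e a b c d)      = InducedCopy K4-e (Vec.lookup (a ∷ b ∷ c ∷ d ∷ []))
Witnesses (p2+p4 a b c d e f) = InducedCopy P2+P4 (Vec.lookup (a ∷ b ∷ c ∷ d ∷ e ∷ f ∷ []))

witnesses? : ∀ {m} (x : Witness m) P → Dec (Witnesses x P)
witnesses? (k4-e _ _ _ _)      = inducedCopy? K4-e _
witnesses? (p2+p4 _ _ _ _ _ _) = inducedCopy? P2+P4 _

Refuted : ∀ {m} → List (Witness m) → Pattern m → Set
Refuted pool P = Any (λ x → Witnesses x P) pool

refuted? : ∀ {m} pool (P : Pattern m) → Dec (Refuted pool P)
refuted? pool P = Any.any? (λ x → witnesses? x P) pool

module _ {n} (G : Graph n) where

  distinguishable⇒images-≢ : ∀ {m} {pt : Fin m → Fin n} {P a b} → Realises G pt P →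
                              Distinguishable P a b → pt a ≢ pt b
  distinguishable⇒images-≢ R (inj₁ (a≢b , Pab)) = Adj⇒≢ G (trans (R _ _ a≢b) Pab)
  distinguishable⇒images-≢ {pt = pt} R (inj₂ (r , a≢r , b≢r , differ)) pa≡pb =
    differ (trans (sym (R _ _ a≢r)) (trans (cong (λ v → adj G v (pt r)) pa≡pb) (R _ _ b≢r)))

  copy⇒induced : ∀ {k m} {pt : Fin m → Fin n} {H : Pattern k} {c P} → Realises G pt P →
                 InducedCopy H c P → InducedIn G k H
  copy⇒induced {pt = pt} {c = c} {P} R copy = pt ∘ c , injective , adjacency
    where
    injective : Injective _≡_ _≡_ (pt ∘ c)
    injective {i} {j} eq =
      decidable-stable (i ≟ j) λ i≢j → distinguishable⇒images-≢ R (proj₂ (copy i j i≢j)) eq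
    adjacency : Realises G (pt ∘ c) _
    adjacency i j i≢j with copy i j i≢j
    ... | Hij , distinct = trans (R _ _ (distinguishable⇒≢ {P = P} distinct)) (sym Hij)

  refuted⇒unrealisable : ¬ InducedIn G 6 P2+P4 → ¬ InducedIn G 4 K4-e →
                          ∀ {m} {pt : Fin m → Fin n} {P pool} → Realises G pt P → ¬ Refuted pool P
  refuted⇒unrealisable P2+P4-free K4-e-free R refuted with Any.satisfied refuted
  ... | k4-e _ _ _ _      , copy = K4-e-free (copy⇒induced R copy)
  ... | p2+p4 _ _ _ _ _ _ , copy = P2+P4-free (copy⇒induced R copy)

-- Traces over an F3

Trace : Set
Trace = Vec Bool 7

Colour : Set
Colour = Fin 6

Table : Set
Table = List (Trace × Colour)

Listed : Table → Trace → Set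
Listed table s = ∃ λ c → (s , c) ∈ table

listed? : ∀ table s → Dec (Listed table s)
listed? table s = any? λ c → Any.any? (≡-dec (Vec.≡-dec Bool._≟_) _≟_ (s , c)) table

record Side : Set where
  field
    corner₁ corner₂ corner₃ : Fin 7
    neighbourColours        : List Colour

  corners : List (Fin 7)
  corners = corner₁ ∷ corner₂ ∷ corner₃ ∷ []
open Side

-- The F3 has vertices v1, …, v5, b1, b4 = 0, …, 6; xSide is the triangle v1 v2 b1, ySide is v4 v5 b4.
xSide ySide : Side
xSide = record { corner₁ = 0 ; corner₂ = 1 ; corner₃ = 5 ; neighbourColours = 0 ∷ 1 ∷ 2 ∷ [] }
ySide = record { corner₁ = 3 ; corner₂ = 4 ; corner₃ = 6 ; neighbourColours = 0 ∷ 1 ∷ 3 ∷ [] }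

OnSide : Side → Trace → Set
OnSide σ s = All (λ k → Vec.lookup s k ≡ true) (corners σ)

onSide? : ∀ σ s → Dec (OnSide σ s)
onSide? σ s = All.all? (λ k → Vec.lookup s k Bool.≟ true) (corners σ)

OnSameSide : Trace → Trace → Set
OnSameSide s s′ = (OnSide xSide s × OnSide xSide s′) ⊎ (OnSide ySide s × OnSide ySide s′)

onSameSide? : ∀ s s′ → Dec (OnSameSide s s′)
onSameSide? s s′ = (onSide? xSide s ×-dec onSide? xSide s′) ⊎-dec (onSide? ySide s ×-dec onSide? ySide s′)

withVertex : Pattern 7 → Trace → Pattern 8
withVertex F s = extend F (Vec.lookup s)

withEdge : Pattern 7 → Trace → Trace → Pattern 9
withEdge F s s′ = extend (withVertex F s) (Vec.lookup (true ∷ s′))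

-- Vertex 0 is u, 1 is x′ and 2 is x, with x′x and ux edges and ux′ an edge iff b.
withEdgeAndNeighbour : Pattern 7 → Trace → Trace → Trace → Bool → Pattern 10
withEdgeAndNeighbour F a a′ s b = extend (withEdge F a a′) (Vec.lookup (b ∷ true ∷ s))

-- The witness pools here and the tables at the end were found by computer search; valid? re-checks
-- them by evaluation.

pool₈ : List (Witness 8)
pool₈ =
    k4-e  1 3 0 2 ∷ k4-e  0 1 2 6 ∷ k4-e  0 2 1 6 ∷ k4-e  0 4 5 7
  ∷ k4-e  0 5 4 7 ∷ k4-e  0 7 4 5 ∷ k4-e  0 6 1 2 ∷ k4-e  3 5 0 4
  ∷ k4-e  1 4 0 5 ∷ p2+p4 0 3 6 1 5 7 ∷ k4-e  2 5 0 1 ∷ p2+p4 1 6 0 3 4 7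
  ∷ p2+p4 1 6 0 7 4 3 ∷ p2+p4 5 7 0 3 2 6 ∷ p2+p4 5 7 0 6 2 3 ∷ k4-e  1 7 0 6
  ∷ k4-e  2 4 0 3 ∷ k4-e  4 6 0 7
  ∷ []

pool₉ : List (Witness 9)
pool₉ =
    p2+p4 0 1 2 7 8 5 ∷ p2+p4 0 1 3 2 6 5 ∷ p2+p4 0 1 3 7 8 6 ∷ k4-e  0 2 1 7
  ∷ k4-e  1 2 0 7 ∷ k4-e  0 5 6 8 ∷ k4-e  0 2 3 7 ∷ k4-e  0 6 5 8
  ∷ k4-e  1 5 6 8 ∷ k4-e  1 2 3 7 ∷ k4-e  1 6 5 8 ∷ p2+p4 0 1 3 2 6 8
  ∷ p2+p4 0 1 3 4 5 8 ∷ p2+p4 2 7 0 1 5 4 ∷ p2+p4 2 7 1 0 5 4 ∷ k4-e  0 3 2 7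
  ∷ p2+p4 5 6 0 1 7 3 ∷ k4-e  0 6 1 5 ∷ k4-e  1 6 0 5 ∷ k4-e  0 7 2 3
  ∷ p2+p4 2 3 0 1 8 5 ∷ p2+p4 2 3 1 0 8 5 ∷ p2+p4 0 1 3 4 5 6 ∷ k4-e  1 7 2 3
  ∷ k4-e  4 8 0 1 ∷ k4-e  0 7 1 2 ∷ k4-e  6 7 0 1 ∷ p2+p4 3 7 0 1 5 6
  ∷ p2+p4 3 7 1 0 5 6 ∷ p2+p4 0 1 5 6 2 7 ∷ k4-e  1 3 0 2 ∷ k4-e  1 5 0 4
  ∷ p2+p4 5 6 1 0 7 3 ∷ k4-e  0 5 1 4 ∷ k4-e  0 6 1 2 ∷ k4-e  0 8 5 6
  ∷ k4-e  1 6 0 2 ∷ k4-e  0 2 1 3 ∷ k4-e  0 3 1 4 ∷ k4-e  0 4 1 3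
  ∷ k4-e  0 5 1 6 ∷ k4-e  1 3 0 4 ∷ p2+p4 0 1 3 7 8 5 ∷ p2+p4 0 1 7 2 6 8
  ∷ p2+p4 2 3 0 1 5 8 ∷ p2+p4 6 8 0 1 4 3 ∷ k4-e  1 5 0 6 ∷ p2+p4 2 3 1 0 5 8
  ∷ p2+p4 5 8 0 1 2 3 ∷ p2+p4 5 8 0 1 3 7 ∷ p2+p4 5 8 0 1 7 3 ∷ p2+p4 5 8 1 0 3 7
  ∷ p2+p4 6 8 1 0 4 3 ∷ k4-e  0 7 1 8 ∷ k4-e  1 7 0 8 ∷ k4-e  1 8 5 6
  ∷ k4-e  2 4 0 1 ∷ k4-e  2 5 0 1 ∷ k4-e  3 5 0 1 ∷ k4-e  3 6 0 1
  ∷ p2+p4 2 7 0 1 4 5 ∷ p2+p4 2 7 1 0 4 5 ∷ p2+p4 3 7 0 1 8 5 ∷ p2+p4 3 7 1 0 8 5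
  ∷ p2+p4 5 8 1 0 2 3 ∷ p2+p4 5 8 1 0 7 2 ∷ p2+p4 6 8 0 1 3 4 ∷ p2+p4 6 8 1 0 3 4
  ∷ []

pool₁₀ : List (Witness 10)
pool₁₀ =
    k4-e  0 4 1 2 ∷ k4-e  0 6 1 2 ∷ k4-e  0 7 2 6 ∷ k4-e  0 1 2 3
  ∷ k4-e  0 1 2 8 ∷ k4-e  0 1 2 7 ∷ k4-e  0 3 2 4 ∷ k4-e  0 1 2 9
  ∷ []

module _ (F : Pattern 7) (table : Table) where

  record SideValid (σ τ : Side) : Set where
    constructor sideValid
    field
      triangle           : AllPairs (λ i j → i ≢ j × F i j ≡ true) (corners σ)
      outside-neighbours :
        All (λ (a , _) → OnSide σ a → All (λ (a′ , _) → OnSide σ a′ → All (λ (s , c) →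
          ¬ OnSide σ s → c ∉ neighbourColours σ →
          ∀ b → Refuted pool₁₀ (withEdgeAndNeighbour F a a′ s b))
        table) table) table
      one-neighbour      :
        All (λ (a , _) → OnSide σ a → All (λ (a′ , _) → OnSide σ a′ → All (λ (s , _) →
          OnSide τ s → Refuted pool₁₀ (withEdgeAndNeighbour F a a′ s true))
        table) table) table

  sideValid? : ∀ σ τ → Dec (SideValid σ τ)
  sideValid? σ τ =
    map′ (λ (t , o , m) → sideValid t o m) (λ (sideValid t o m) → t , o , m)
      (AllPairs.allPairs? (λ i j → ¬? (i ≟ j) ×-dec F i j Bool.≟ true) (corners σ) ×-dec
       All.all? (λ (a , _) → onSide? σ a →-dec
         All.all? (λ (a′ , _) → onSide? σ a′ →-dec
           All.all? (λ (s , c) → ¬? (onSide? σ s) →-dec ¬? (Any.any? (c ≟_) (neighbourColours σ)) →-dec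
             all-bools? λ b → refuted? pool₁₀ (withEdgeAndNeighbour F a a′ s b))
           table) table) table ×-dec
       All.all? (λ (a , _) → onSide? σ a →-dec
         All.all? (λ (a′ , _) → onSide? σ a′ →-dec
           All.all? (λ (s , _) → onSide? τ s →-dec refuted? pool₁₀ (withEdgeAndNeighbour F a a′ s true))
           table) table) table)

  record Valid : Set where
    constructor valid
    field
      listed-or-refuted : ∀ s → Listed table s ⊎ Refuted pool₈ (withVertex F s)
      equal-colours     :
        All (λ (s , c) → All (λ (s′ , c′) →
          c ≡ c′ → ¬ OnSameSide s s′ → Refuted pool₉ (withEdge F s s′))
        table) table
      x-side            : SideValid xSide ySide
      y-side            : SideValid ySide xSide

  valid? : Dec Valid
  valid? =
    map′ (λ (l , e , x , y) → valid l e x y) (λ (valid l e x y) → l , e , x , y)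
      (all-vectors? (λ s → listed? table s ⊎-dec refuted? pool₈ (withVertex F s)) ×-dec
       All.all? (λ (s , c) → All.all? (λ (s′ , c′) →
         c ≟ c′ →-dec ¬? (onSameSide? s s′) →-dec refuted? pool₉ (withEdge F s s′))
       table) table ×-dec
       sideValid? xSide ySide ×-dec
       sideValid? ySide xSide)

-- The argument around a fixed F3

xPalette : ∀ {m} → Fin m → Fin (3 + m)
xPalette = 3 ↑ʳ_

yPalette : ∀ {m} → Fin m → Fin (3 + m)
yPalette zero    = 2
yPalette (suc j) = xPalette (suc j)

xPalette-injective : ∀ {m} {i j : Fin m} → xPalette i ≡ xPalette j → i ≡ j
xPalette-injective = ↑ʳ-injective 3 _ _

yPalette-injective : ∀ {m} {i j : Fin m} → yPalette i ≡ yPalette j → i ≡ j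
yPalette-injective {i = zero}  {zero}  _  = refl
yPalette-injective {i = suc i} {suc j} eq = xPalette-injective eq

xPalette≡yPalette⇒≡ : ∀ {m} {i j : Fin m} → xPalette i ≡ yPalette j → i ≡ j
xPalette≡yPalette⇒≡ {j = suc j} eq = xPalette-injective eq

xPalette-avoids : ∀ {m} .(6≤ : 6 ≤ 3 + m) {c} → c ∈ neighbourColours xSide →
                  ∀ i → xPalette i ≢ inject≤ c 6≤
xPalette-avoids _ (here refl)                 _ ()
xPalette-avoids _ (there (here refl))         _ ()
xPalette-avoids _ (there (there (here refl))) _ ()

yPalette-avoids : ∀ {m} .(6≤ : 6 ≤ 3 + m) {c} → c ∈ neighbourColours ySide →
                  ∀ i → yPalette i ≢ inject≤ c 6≤
yPalette-avoids _ (here refl)                 zero    ()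
yPalette-avoids _ (here refl)                 (suc _) ()
yPalette-avoids _ (there (here refl))         zero    ()
yPalette-avoids _ (there (here refl))         (suc _) ()
yPalette-avoids _ (there (there (here refl))) zero    ()
yPalette-avoids _ (there (there (here refl))) (suc _) ()

module AroundF3 {n} (G : Graph n) (P2+P4-free : ¬ InducedIn G 6 P2+P4) (K4-e-free : ¬ InducedIn G 4 K4-e)
                {F : Pattern 7} {table : Table} (F-valid : Valid F table)
                (w : Fin 7 → Fin n) (w-realises : Realises G w F) where

  open Valid F-valid

  trace : Fin n → Trace
  trace u = Vec.tabulate λ k → adj G u (w k)

  adj≡trace : ∀ u k → adj G u (w k) ≡ Vec.lookup (trace u) k
  adj≡trace u k = sym (Vec.lookup∘tabulate (λ k → adj G u (w k)) k)

  unrealisable : ∀ {m} {pt : Fin m → Fin n} {P pool} → Realises G pt P → ¬ Refuted pool P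
  unrealisable = refuted⇒unrealisable G P2+P4-free K4-e-free

  realises-vertex : ∀ u → Realises G (u ◃ w) (withVertex F (trace u))
  realises-vertex u = realises-◃ G w-realises (adj≡trace u)

  realises-edge : ∀ {u v} → Adj G v u → Realises G (v ◃ u ◃ w) (withEdge F (trace u) (trace v))
  realises-edge {u} {v} vu = realises-◃ G (realises-vertex u) λ { zero → vu ; (suc k) → adj≡trace v k }

  realises-edge-and-neighbour : ∀ {x x′ u} → Adj G x′ x → Adj G u x →
    Realises G (u ◃ x′ ◃ x ◃ w) (withEdgeAndNeighbour F (trace x) (trace x′) (trace u) (adj G u x′))
  realises-edge-and-neighbour {u = u} x′x ux = realises-◃ G (realises-edge x′x)
    λ { zero → refl ; (suc zero) → ux ; (suc (suc k)) → adj≡trace u k }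

  listed : ∀ u → Listed table (trace u)
  listed u = [ id , ⊥-elim ∘ unrealisable (realises-vertex u) ]′ (listed-or-refuted (trace u))

  baseColour : Fin n → Colour
  baseColour = proj₁ ∘ listed

  entry∈table : ∀ u → (trace u , baseColour u) ∈ table
  entry∈table = proj₂ ∘ listed

  equal-base-colours⇒same-side : ∀ {u v} → Adj G u v → baseColour u ≡ baseColour v →
                                 OnSameSide (trace u) (trace v)
  equal-base-colours⇒same-side {u} {v} uv same = decidable-stable (onSameSide? (trace u) (trace v)) λ ¬same →
    unrealisable (realises-edge (Adj-sym G uv))
      (All.lookup (All.lookup equal-colours (entry∈table u)) (entry∈table v) same ¬same)

  module SideLemmas (σ τ : Side) (σ-valid : SideValid F table σ τ) where
    open SideValid σ-valid

    Member : Fin n → Set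
    Member u = OnSide σ (trace u)

    open Enumeration {P = Member} (onSide? σ ∘ trace) public

    corners-clique : AllPairs (Adj G) (map w (corners σ))
    corners-clique =
      AllPairsₚ.map⁺ (AllPairs.map (λ (i≢j , Fij) → trans (w-realises _ _ i≢j) Fij) triangle)

    adjacent-to-corners : ∀ {u} → Member u → All (λ k → Adj G u (w k)) (corners σ)
    adjacent-to-corners {u} = All.map (trans (adj≡trace u _))

    members-adjacent : ∀ {x x′} → Member x → Member x′ → x ≢ x′ → Adj G x x′
    members-adjacent x∈ x′∈ =
      common-neighbours-adjacent G K4-e-free (All.head (AllPairs.head corners-clique))
        (All.head (adjacent-to-corners x∈))  (All.head (All.tail (adjacent-to-corners x∈)))
        (All.head (adjacent-to-corners x′∈)) (All.head (All.tail (adjacent-to-corners x′∈)))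

    clique : HasClique G (3 + size)
    clique = allPairs⇒clique G (AllPairsₚ.++⁺ corners-clique (members-pairwise members-adjacent)
      (Allₚ.map⁺ (All.tabulate λ k∈ → All.tabulate λ x∈ →
        Adj-sym G (All.lookup (adjacent-to-corners (∈members⇒P x∈)) k∈))))

    outside-neighbour-colour : ∀ {x x′ u} → Member x → Member x′ → x ≢ x′ →
                               ¬ Member u → Adj G u x → baseColour u ∈ neighbourColours σ
    outside-neighbour-colour {x} {x′} {u} x∈ x′∈ x≢x′ u∉ ux =
      decidable-stable (Any.any? (baseColour u ≟_) _) λ colour∉ →
        unrealisable (realises-edge-and-neighbour (members-adjacent x′∈ x∈ (≢-sym x≢x′)) ux)
          (All.lookup (All.lookup (All.lookup outside-neighbours (entry∈table x) x∈) (entry∈table x′) x′∈)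
             (entry∈table u) u∉ colour∉ (adj G u x′))

    at-most-one-neighbour : ∀ {x x′ y} → Member x → Member x′ → x ≢ x′ → OnSide τ (trace y) →
                            Adj G y x → Adj G y x′ → ⊥
    at-most-one-neighbour {x} {x′} {y} x∈ x′∈ x≢x′ y∈ yx yx′ =
      unrealisable
        (subst (Realises G (y ◃ x′ ◃ x ◃ w) ∘ withEdgeAndNeighbour F (trace x) (trace x′) (trace y)) yx′
           (realises-edge-and-neighbour (members-adjacent x′∈ x∈ (≢-sym x≢x′)) yx))
        (All.lookup (All.lookup (All.lookup one-neighbour (entry∈table x) x∈) (entry∈table x′) x′∈)
           (entry∈table y) y∈)

    Paired : Fin n → Set
    Paired u = Member u × ∃ λ v → Member v × v ≢ u

    paired? : Decidable Paired
    paired? u = onSide? σ (trace u) ×-dec any? λ v → onSide? σ (trace v) ×-dec ¬? (v ≟ u)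

    paired-with : ∀ {u v} → Member u → Member v → u ≢ v → Paired u
    paired-with u∈ v∈ u≢v = u∈ , _ , v∈ , ≢-sym u≢v

  module X = SideLemmas xSide ySide x-side
  module Y = SideLemmas ySide xSide y-side

  p q M : ℕ
  p = X.size
  q = Y.size
  M = 3 ⊔ p ⊔ q

  p≤M : p ≤ M
  p≤M = ≤-trans (m≤n⊔m 3 p) (m≤m⊔n _ q)

  q≤M : q ≤ M
  q≤M = m≤n⊔m _ q

  3≤M : 3 ≤ M
  3≤M = ≤-trans (m≤m⊔n 3 p) (m≤m⊔n _ q)

  6≤3+M : 6 ≤ 3 + M
  6≤3+M = s≤s (s≤s (s≤s 3≤M))

  widen : Fin p → Fin M
  widen i = inject≤ i p≤M

  Forbidden : Fin q → Fin M → Set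
  Forbidden j c = ∃ λ i → Adj G (X.member i) (Y.member j) × widen i ≡ c

  yChoice : AvoidingInjection Forbidden
  yChoice = avoiding-injection q≤M (≤-trans (s≤s (s≤s z≤n)) 3≤M)
    (λ j c → any? λ i → adj G (X.member i) (Y.member j) Bool.≟ true ×-dec widen i ≟ c)
    (λ { (i , ij , refl) (i′ , i′j , refl) → cong widen (same-x ij i′j) })
    (λ { (i , ij , refl) (i′ , i′j′ , widen-i′≡widen-i) →
         same-y ij (subst (λ i → Adj G (X.member i) _)
                          (inject≤-injective p≤M p≤M i′ i widen-i′≡widen-i) i′j′) })
    where
    same-x : ∀ {i i′ j} → Adj G (X.member i) (Y.member j) → Adj G (X.member i′) (Y.member j) → i ≡ i′
    same-x {i} {i′} {j} ij i′j = decidable-stable (i ≟ i′) λ i≢i′ →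
      X.at-most-one-neighbour (X.member-satisfies i) (X.member-satisfies i′) (i≢i′ ∘ X.member-injective)
        (Y.member-satisfies j) (Adj-sym G ij) (Adj-sym G i′j)
    same-y : ∀ {i j j′} → Adj G (X.member i) (Y.member j) → Adj G (X.member i) (Y.member j′) → j ≡ j′
    same-y {i} {j} {j′} ij ij′ = decidable-stable (j ≟ j′) λ j≢j′ →
      Y.at-most-one-neighbour (Y.member-satisfies j) (Y.member-satisfies j′) (j≢j′ ∘ Y.member-injective)
        (X.member-satisfies i) ij ij′

  open AvoidingInjection yChoice renaming (choice to ySlot; injective to ySlot-injective; avoids to ySlot-avoids)

  xIndex : ∀ {u} → X.Member u → Fin M
  xIndex = widen ∘ X.position

  yIndex : ∀ {u} → Y.Member u → Fin M
  yIndex = ySlot ∘ Y.position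

  data Kind (u : Fin n) : Set where
    x-kind    : X.Paired u → Kind u
    y-kind    : ¬ X.Paired u → Y.Paired u → Kind u
    base-kind : ¬ X.Paired u → ¬ Y.Paired u → Kind u

  kind : ∀ u → Kind u
  kind u with X.paired? u | Y.paired? u
  ... | yes x-paired | _            = x-kind x-paired
  ... | no ¬x-paired | yes y-paired = y-kind ¬x-paired y-paired
  ... | no ¬x-paired | no ¬y-paired = base-kind ¬x-paired ¬y-paired

  colourOf : ∀ {u} → Kind u → Fin (3 + M)
  colourOf     (x-kind (u∈ , _))   = xPalette (xIndex u∈)
  colourOf     (y-kind _ (u∈ , _)) = yPalette (yIndex u∈)
  colourOf {u} (base-kind _ _)     = inject≤ (baseColour u) 6≤3+M

  proper : ∀ {u v} → Adj G u v → (ku : Kind u) (kv : Kind v) → colourOf ku ≢ colourOf kv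
  proper uv (x-kind (u∈ , _)) (x-kind (v∈ , _)) eq =
    Adj⇒≢ G uv (X.position-injective u∈ v∈ (inject≤-injective p≤M p≤M _ _ (xPalette-injective eq)))
  proper uv (x-kind (u∈ , _)) (y-kind _ (v∈ , _)) eq =
    ySlot-avoids (Y.position v∈)
      (X.position u∈ , subst₂ (Adj G) (sym (X.member-position u∈)) (sym (Y.member-position v∈)) uv
                     , xPalette≡yPalette⇒≡ eq)
  proper {u} {v} uv (x-kind (u∈ , x , x∈ , x≢u)) (base-kind ¬v-paired _) =
    xPalette-avoids 6≤3+M (X.outside-neighbour-colour u∈ x∈ (≢-sym x≢u) v∉X (Adj-sym G uv)) (xIndex u∈)
    where
    v∉X : ¬ X.Member v
    v∉X v∈ = ¬v-paired (X.paired-with v∈ u∈ (≢-sym (Adj⇒≢ G uv)))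
  proper uv (y-kind _ (u∈ , _)) (y-kind _ (v∈ , _)) eq =
    Adj⇒≢ G uv (Y.position-injective u∈ v∈ (ySlot-injective (yPalette-injective eq)))
  proper {u} {v} uv (y-kind _ (u∈ , y , y∈ , y≢u)) (base-kind _ ¬v-paired) =
    yPalette-avoids 6≤3+M (Y.outside-neighbour-colour u∈ y∈ (≢-sym y≢u) v∉Y (Adj-sym G uv)) (yIndex u∈)
    where
    v∉Y : ¬ Y.Member v
    v∉Y v∈ = ¬v-paired (Y.paired-with v∈ u∈ (≢-sym (Adj⇒≢ G uv)))
  proper uv (base-kind ¬x-paired ¬y-paired) (base-kind _ _) eq
    with equal-base-colours⇒same-side uv (inject≤-injective 6≤3+M 6≤3+M _ _ eq)
  ... | inj₁ (u∈ , v∈) = ¬x-paired (X.paired-with u∈ v∈ (Adj⇒≢ G uv))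
  ... | inj₂ (u∈ , v∈) = ¬y-paired (Y.paired-with u∈ v∈ (Adj⇒≢ G uv))
  proper uv ku@(y-kind _ _)    kv@(x-kind _)   = proper (Adj-sym G uv) kv ku ∘ sym
  proper uv ku@(base-kind _ _) kv@(x-kind _)   = proper (Adj-sym G uv) kv ku ∘ sym
  proper uv ku@(base-kind _ _) kv@(y-kind _ _) = proper (Adj-sym G uv) kv ku ∘ sym

  colourable : Colorable G (3 + M)
  colourable = (λ u → colourOf (kind u)) , λ u v uv → proper uv (kind u) (kind v)

  χ≤6⊎χ≡ω : Colorable G 6 ⊎ ∃ λ k → IsChromaticNumber G k × IsCliqueNumber G k
  χ≤6⊎χ≡ω = colouring+cliques⇒χ≤6⊎χ≡ω G colourable X.clique Y.clique

table₀ : Table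
table₀ =
    (false ∷ false ∷ false ∷ false ∷ false ∷ false ∷ false ∷ [] , 0)
  ∷ (true  ∷ false ∷ false ∷ false ∷ false ∷ false ∷ false ∷ [] , 0)
  ∷ (false ∷ true  ∷ false ∷ false ∷ false ∷ false ∷ false ∷ [] , 1)
  ∷ (true  ∷ true  ∷ false ∷ false ∷ false ∷ false ∷ false ∷ [] , 1)
  ∷ (false ∷ false ∷ false ∷ true  ∷ false ∷ false ∷ false ∷ [] , 2)
  ∷ (true  ∷ false ∷ false ∷ true  ∷ false ∷ false ∷ false ∷ [] , 1)
  ∷ (false ∷ true  ∷ false ∷ true  ∷ false ∷ false ∷ false ∷ [] , 2)
  ∷ (false ∷ false ∷ false ∷ false ∷ true  ∷ false ∷ false ∷ [] , 2)
  ∷ (true  ∷ false ∷ false ∷ false ∷ true  ∷ false ∷ false ∷ [] , 1)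
  ∷ (false ∷ true  ∷ false ∷ false ∷ true  ∷ false ∷ false ∷ [] , 2)
  ∷ (true  ∷ false ∷ true  ∷ false ∷ true  ∷ false ∷ false ∷ [] , 4)
  ∷ (false ∷ false ∷ false ∷ true  ∷ true  ∷ false ∷ false ∷ [] , 1)
  ∷ (true  ∷ true  ∷ false ∷ false ∷ false ∷ true  ∷ false ∷ [] , 3)
  ∷ (false ∷ false ∷ true  ∷ false ∷ false ∷ true  ∷ false ∷ [] , 3)
  ∷ (true  ∷ false ∷ true  ∷ false ∷ false ∷ true  ∷ false ∷ [] , 0)
  ∷ (true  ∷ true  ∷ false ∷ true  ∷ false ∷ true  ∷ false ∷ [] , 3)
  ∷ (false ∷ false ∷ true  ∷ true  ∷ false ∷ true  ∷ false ∷ [] , 3)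
  ∷ (false ∷ false ∷ false ∷ false ∷ true  ∷ true  ∷ false ∷ [] , 0)
  ∷ (false ∷ true  ∷ false ∷ false ∷ true  ∷ true  ∷ false ∷ [] , 2)
  ∷ (false ∷ false ∷ true  ∷ false ∷ true  ∷ true  ∷ false ∷ [] , 0)
  ∷ (true  ∷ false ∷ false ∷ false ∷ false ∷ false ∷ true  ∷ [] , 4)
  ∷ (false ∷ false ∷ true  ∷ false ∷ false ∷ false ∷ true  ∷ [] , 0)
  ∷ (true  ∷ false ∷ true  ∷ false ∷ false ∷ false ∷ true  ∷ [] , 3)
  ∷ (false ∷ true  ∷ true  ∷ false ∷ false ∷ false ∷ true  ∷ [] , 3)
  ∷ (true  ∷ false ∷ false ∷ true  ∷ false ∷ false ∷ true  ∷ [] , 3)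
  ∷ (false ∷ false ∷ true  ∷ false ∷ true  ∷ false ∷ true  ∷ [] , 0)
  ∷ (false ∷ false ∷ false ∷ true  ∷ true  ∷ false ∷ true  ∷ [] , 2)
  ∷ (false ∷ true  ∷ false ∷ true  ∷ true  ∷ false ∷ true  ∷ [] , 2)
  ∷ (false ∷ false ∷ false ∷ false ∷ false ∷ true  ∷ true  ∷ [] , 0)
  ∷ (true  ∷ true  ∷ false ∷ false ∷ false ∷ true  ∷ true  ∷ [] , 3)
  ∷ (false ∷ false ∷ true  ∷ false ∷ false ∷ true  ∷ true  ∷ [] , 0)
  ∷ (false ∷ false ∷ false ∷ true  ∷ true  ∷ true  ∷ true  ∷ [] , 2)
  ∷ []

table₁ : Table
table₁ =
    (false ∷ false ∷ false ∷ false ∷ false ∷ false ∷ false ∷ [] , 0)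
  ∷ (true  ∷ false ∷ false ∷ false ∷ false ∷ false ∷ false ∷ [] , 1)
  ∷ (false ∷ true  ∷ false ∷ false ∷ false ∷ false ∷ false ∷ [] , 0)
  ∷ (false ∷ false ∷ true  ∷ false ∷ false ∷ false ∷ false ∷ [] , 0)
  ∷ (true  ∷ false ∷ true  ∷ false ∷ false ∷ false ∷ false ∷ [] , 3)
  ∷ (false ∷ true  ∷ true  ∷ false ∷ false ∷ false ∷ false ∷ [] , 0)
  ∷ (false ∷ false ∷ false ∷ true  ∷ false ∷ false ∷ false ∷ [] , 1)
  ∷ (true  ∷ false ∷ false ∷ true  ∷ false ∷ false ∷ false ∷ [] , 1)
  ∷ (false ∷ true  ∷ false ∷ true  ∷ false ∷ false ∷ false ∷ [] , 2)
  ∷ (false ∷ false ∷ true  ∷ true  ∷ false ∷ false ∷ false ∷ [] , 1)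
  ∷ (true  ∷ false ∷ true  ∷ true  ∷ false ∷ false ∷ false ∷ [] , 1)
  ∷ (false ∷ false ∷ false ∷ false ∷ true  ∷ false ∷ false ∷ [] , 0)
  ∷ (true  ∷ false ∷ false ∷ false ∷ true  ∷ false ∷ false ∷ [] , 5)
  ∷ (false ∷ true  ∷ false ∷ false ∷ true  ∷ false ∷ false ∷ [] , 0)
  ∷ (false ∷ false ∷ true  ∷ false ∷ true  ∷ false ∷ false ∷ [] , 0)
  ∷ (true  ∷ false ∷ true  ∷ false ∷ true  ∷ false ∷ false ∷ [] , 5)
  ∷ (false ∷ true  ∷ true  ∷ false ∷ true  ∷ false ∷ false ∷ [] , 0)
  ∷ (false ∷ false ∷ false ∷ false ∷ false ∷ true  ∷ false ∷ [] , 3)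
  ∷ (true  ∷ true  ∷ false ∷ false ∷ false ∷ true  ∷ false ∷ [] , 3)
  ∷ (false ∷ false ∷ true  ∷ false ∷ false ∷ true  ∷ false ∷ [] , 1)
  ∷ (true  ∷ false ∷ true  ∷ false ∷ false ∷ true  ∷ false ∷ [] , 1)
  ∷ (false ∷ false ∷ false ∷ true  ∷ false ∷ true  ∷ false ∷ [] , 3)
  ∷ (true  ∷ true  ∷ false ∷ true  ∷ false ∷ true  ∷ false ∷ [] , 3)
  ∷ (false ∷ false ∷ true  ∷ true  ∷ false ∷ true  ∷ false ∷ [] , 3)
  ∷ (false ∷ false ∷ false ∷ false ∷ true  ∷ true  ∷ false ∷ [] , 3)
  ∷ (false ∷ true  ∷ false ∷ false ∷ true  ∷ true  ∷ false ∷ [] , 0)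
  ∷ (false ∷ false ∷ true  ∷ false ∷ true  ∷ true  ∷ false ∷ [] , 4)
  ∷ (false ∷ false ∷ false ∷ true  ∷ true  ∷ true  ∷ false ∷ [] , 3)
  ∷ (false ∷ false ∷ false ∷ false ∷ false ∷ false ∷ true  ∷ [] , 1)
  ∷ (true  ∷ false ∷ false ∷ false ∷ false ∷ false ∷ true  ∷ [] , 1)
  ∷ (false ∷ true  ∷ false ∷ false ∷ false ∷ false ∷ true  ∷ [] , 2)
  ∷ (true  ∷ true  ∷ false ∷ false ∷ false ∷ false ∷ true  ∷ [] , 2)
  ∷ (false ∷ false ∷ true  ∷ false ∷ false ∷ false ∷ true  ∷ [] , 0)
  ∷ (true  ∷ false ∷ true  ∷ false ∷ false ∷ false ∷ true  ∷ [] , 5)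
  ∷ (false ∷ true  ∷ true  ∷ false ∷ false ∷ false ∷ true  ∷ [] , 4)
  ∷ (true  ∷ false ∷ false ∷ true  ∷ false ∷ false ∷ true  ∷ [] , 1)
  ∷ (false ∷ false ∷ true  ∷ false ∷ true  ∷ false ∷ true  ∷ [] , 0)
  ∷ (false ∷ false ∷ false ∷ true  ∷ true  ∷ false ∷ true  ∷ [] , 2)
  ∷ (false ∷ true  ∷ false ∷ true  ∷ true  ∷ false ∷ true  ∷ [] , 2)
  ∷ (false ∷ false ∷ false ∷ false ∷ false ∷ true  ∷ true  ∷ [] , 4)
  ∷ (false ∷ false ∷ true  ∷ false ∷ false ∷ true  ∷ true  ∷ [] , 4)
  ∷ []

valid₀ : Valid F3-nonadj table₀
valid₀ = from-yes (valid? F3-nonadj table₀)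

valid₁ : Valid F3-adj table₁
valid₁ = from-yes (valid? F3-adj table₁)

lemma3p3 : ∀ {n : ℕ} (G : Graph n) →
    ¬ InducedIn G 6 P2+P4 →
    ¬ InducedIn G 4 K4-e →
    ContainsF3 G →
    Colorable G 6 ⊎ ∃ (λ k → IsChromaticNumber G k × IsCliqueNumber G k)
lemma3p3 G P2+P4-free K4-e-free (inj₁ (w , _ , w-realises)) =
  AroundF3.χ≤6⊎χ≡ω G P2+P4-free K4-e-free valid₀ w w-realises
lemma3p3 G P2+P4-free K4-e-free (inj₂ (w , _ , w-realises)) =
  AroundF3.χ≤6⊎χ≡ω G P2+P4-free K4-e-free valid₁ w w-realises
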